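{- Let $E$ be a finite set with $E\neq\varnothing$, let $\operatorname{Shade}:\mathcal{P}(E)\to\mathcal{P}(E)$ be a shade map on $E$, and let $G$ be any subset of $E$. Then \[ \sum_{\substack{F\subseteq E;\\ G\subseteq \operatorname{Shade}F}}(-1)^{|F|}=0 . \]
   Context: $\mathcal{P}(E)$ denotes the power set of $E$. A shade map on a set $E$ is a map $\operatorname{Shade}:\mathcal{P}(E)\to\mathcal{P}(E)$ such that for every $F\subseteq E$ and every $u\in E\setminus\operatorname{Shade}F$ we have $\operatorname{Shade}(F\cup\{u\})=\operatorname{Shade}F$ (Axiom 1) and $\operatorname{Shade}(F\setminus\{u\})=\operatorname{Shade}F$ (Axiom 2). -}

module Defs where

open import Data.Nat using (ℕ; zero; suc)
open import Data.Integer using (ℤ; 0ℤ; 1ℤ; -_; _+_)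
open import Data.Bool using (true; false)
open import Data.List using (List; []; _∷_; map; _++_; filter; foldr)
open import Data.Vec using (Vec; []; _∷_)
open import Data.Fin using (Fin)
open import Data.Fin.Subset using (Subset; _∈_; _∉_; _∪_; _-_; ⁅_⁆; ∣_∣; _⊆_)
open import Data.Fin.Subset.Properties using (_⊆?_)
open import Relation.Binary.PropositionalEquality using (_≡_)

-- A finite set E is modelled as Fin n; P(E) as Subset n.
-- Shade map on Fin n: a function P(E) → P(E) satisfying Axioms 1 and 2.
record IsShadeMap {n : ℕ} (Shade : Subset n → Subset n) : Set where
  field
    axiom1 : ∀ (F : Subset n) (u : Fin n) → u ∉ Shade F → Shade (F ∪ ⁅ u ⁆) ≡ Shade F
    axiom2 : ∀ (F : Subset n) (u : Fin n) → u ∉ Shade F → Shade (F - u) ≡ Shade F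

allSubsets : (n : ℕ) → List (Subset n)
allSubsets zero = [] ∷ []
allSubsets (suc n) = map (false ∷_) (allSubsets n) ++ map (true ∷_) (allSubsets n)

sign : ℕ → ℤ
sign zero = 1ℤ
sign (suc k) = - sign k

sumℤ : List ℤ → ℤ
sumℤ = foldr _+_ 0ℤ

shadeSum : {n : ℕ} → (Subset n → Subset n) → Subset n → ℤ
shadeSum {n} Shade G =
  sumℤ (map (λ F → sign ∣ F ∣) (filter (λ F → G ⊆? Shade F) (allSubsets n)))

-- A shade map does not change when one toggles a point lying outside the
-- shade. So, toggling at a point outside Shade F is a sign-reversing involution
-- on the subsets F with Shade F ≠ E, and it preserves the condition G ⊆ Shade F.
-- The sum therefore reduces to the subsets F with Shade F = E, which all satisfy
-- G ⊆ Shade F; hence it does not depend on G. For G = ∅ it is Σ_F (-1)^|F| = 0,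
-- as E ≠ ∅.
module Submission where

open import Defs
open import Data.Nat using (ℕ; zero; suc)
open import Data.Integer using (ℤ; 0ℤ; -_; _+_)
open import Data.Integer.Properties
  using (+-assoc; +-identityˡ; +-identityʳ; +-inverseʳ; neg-involutive; neg-distrib-+; +-commutativeSemigroup)
open import Algebra.Properties.CommutativeSemigroup +-commutativeSemigroup using (interchange)
open import Data.Bool using (true; false; not; if_then_else_)
open import Data.Bool.Properties using (∨-identityʳ)
open import Data.Fin using (Fin; zero; suc)
open import Data.Fin.Subset using (Subset; _∈_; _∉_; _⊆_; _∪_; _-_; ⁅_⁆; ∣_∣; ∁; ⊥)
open import Data.Fin.Subset.Properties
  using (_⊆?_; _∈?_; ⊆-min; nonempty?; x∉p⇒x∈∁p; x∈∁p⇒x∉p; ∪-identityʳ; p─⊥≡p)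
open import Data.List using (List; []; _∷_; map; _++_; filter)
open import Data.List.Properties using (map-++; map-∘)
open import Data.Maybe using (Maybe; just; nothing)
open import Data.Product using (_×_; _,_; proj₁)
open import Data.Vec using ([]; _∷_; here; there; updateAt)
open import Relation.Nullary using (does; yes; no; contradiction)
open import Relation.Nullary.Decidable using (dec-true)
open import Relation.Unary using (Pred; Decidable)
open import Relation.Binary.PropositionalEquality
  using (_≡_; refl; sym; trans; cong; cong₂; module ≡-Reasoning)

open ≡-Reasoning

sumOver : (n : ℕ) → (Subset n → ℤ) → ℤ
sumOver zero    f = f []
sumOver (suc n) f = sumOver n (λ X → f (false ∷ X)) + sumOver n (λ X → f (true ∷ X))

sumOver-cong : ∀ n {f g : Subset n → ℤ} → (∀ F → f F ≡ g F) → sumOver n f ≡ sumOver n g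
sumOver-cong zero    f≗g = f≗g []
sumOver-cong (suc n) f≗g =
  cong₂ _+_ (sumOver-cong n (λ X → f≗g (false ∷ X))) (sumOver-cong n (λ X → f≗g (true ∷ X)))

sumOver-+ : ∀ n (f g : Subset n → ℤ) → sumOver n (λ F → f F + g F) ≡ sumOver n f + sumOver n g
sumOver-+ zero    f g = refl
sumOver-+ (suc n) f g = trans
  (cong₂ _+_ (sumOver-+ n _ _) (sumOver-+ n _ _))
  (interchange (sumOver n (λ X → f (false ∷ X))) (sumOver n (λ X → g (false ∷ X)))
               (sumOver n (λ X → f (true ∷ X))) (sumOver n (λ X → g (true ∷ X))))

sumOver-neg : ∀ n (f : Subset n → ℤ) → sumOver n (λ F → - f F) ≡ - sumOver n f
sumOver-neg zero    f = refl
sumOver-neg (suc n) f = trans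
  (cong₂ _+_ (sumOver-neg n _) (sumOver-neg n _))
  (sym (neg-distrib-+ (sumOver n (λ X → f (false ∷ X))) (sumOver n (λ X → f (true ∷ X)))))

sumOver-antisymmetric-head : ∀ n (f : Subset (suc n) → ℤ) →
  (∀ X → f (true ∷ X) ≡ - f (false ∷ X)) → sumOver (suc n) f ≡ 0ℤ
sumOver-antisymmetric-head n f anti = begin
  sumOver n (λ X → f (false ∷ X)) + sumOver n (λ X → f (true ∷ X))
    ≡⟨ cong (sumOver n (λ X → f (false ∷ X)) +_) (sumOver-cong n anti) ⟩
  sumOver n (λ X → f (false ∷ X)) + sumOver n (λ X → - f (false ∷ X))
    ≡⟨ cong (sumOver n (λ X → f (false ∷ X)) +_) (sumOver-neg n _) ⟩
  sumOver n (λ X → f (false ∷ X)) + - sumOver n (λ X → f (false ∷ X))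
    ≡⟨ +-inverseʳ (sumOver n (λ X → f (false ∷ X))) ⟩
  0ℤ ∎

toggle : ∀ {n} → Fin n → Subset n → Subset n
toggle i F = updateAt F i not

toggle-∈ : ∀ {n} (i : Fin n) F → i ∈ F → toggle i F ≡ F - i
toggle-∈ zero    (true ∷ X) here       = cong (false ∷_) (sym (p─⊥≡p X))
toggle-∈ (suc i) (b ∷ X)    (there i∈X) = cong (b ∷_) (toggle-∈ i X i∈X)

toggle-∉ : ∀ {n} (i : Fin n) F → i ∉ F → toggle i F ≡ F ∪ ⁅ i ⁆
toggle-∉ zero    (true ∷ X)  i∉F = contradiction here i∉F
toggle-∉ zero    (false ∷ X) i∉F = cong (true ∷_) (sym (∪-identityʳ X))
toggle-∉ (suc i) (b ∷ X)     i∉F = cong₂ _∷_ (sym (∨-identityʳ b)) (toggle-∉ i X (λ i∈X → i∉F (there i∈X)))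

sign-toggle : ∀ {n} (i : Fin n) F → sign ∣ toggle i F ∣ ≡ - sign ∣ F ∣
sign-toggle zero    (false ∷ X) = refl
sign-toggle zero    (true ∷ X)  = sym (neg-involutive _)
sign-toggle (suc i) (false ∷ X) = sign-toggle i X
sign-toggle (suc i) (true ∷ X)  = cong -_ (sign-toggle i X)

-- A selector c picks for each F a coordinate at which toggling F reverses the
-- sign of f and keeps the selection; F is a fixed point when nothing is picked.
SignReversing : ∀ {n} → (Subset n → Maybe (Fin n)) → (Subset n → ℤ) → Set
SignReversing c f = ∀ F i → c F ≡ just i → c (toggle i F) ≡ just i × f (toggle i F) ≡ - f F

onNothing : ∀ {n} → Maybe (Fin n) → ℤ → ℤ
onNothing nothing  x = x
onNothing (just _) x = 0ℤ

module _ {n : ℕ} where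

  onHead : Maybe (Fin (suc n)) → ℤ → ℤ
  onHead (just zero) x = x
  onHead _           x = 0ℤ

  offHead : Maybe (Fin (suc n)) → ℤ → ℤ
  offHead (just zero) x = 0ℤ
  offHead _           x = x

  predMaybe : Maybe (Fin (suc n)) → Maybe (Fin n)
  predMaybe (just (suc j)) = just j
  predMaybe _              = nothing

  onHead+offHead : ∀ s x → onHead s x + offHead s x ≡ x
  onHead+offHead (just zero)    x = +-identityʳ x
  onHead+offHead (just (suc _)) x = +-identityˡ x
  onHead+offHead nothing        x = +-identityˡ x

  onNothing-predMaybe : ∀ s x → onNothing (predMaybe s) (offHead s x) ≡ onNothing s x
  onNothing-predMaybe (just zero)    x = refl
  onNothing-predMaybe (just (suc _)) x = refl
  onNothing-predMaybe nothing        x = refl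

  predMaybe-just : ∀ s j → predMaybe s ≡ just j → s ≡ just (suc j)
  predMaybe-just (just (suc j)) .j refl = refl

  onHead-antisymmetric : ∀ s t x y →
    (s ≡ just zero → t ≡ just zero × y ≡ - x) → (t ≡ just zero → s ≡ just zero) →
    onHead t y ≡ - onHead s x
  onHead-antisymmetric (just zero) t x y forth _ with forth refl
  ... | refl , y≡-x = y≡-x
  onHead-antisymmetric (just (suc _)) (just zero) x y _ back with back refl
  ... | ()
  onHead-antisymmetric nothing (just zero) x y _ back with back refl
  ... | ()
  onHead-antisymmetric (just (suc _)) (just (suc _)) x y _ _ = refl
  onHead-antisymmetric (just (suc _)) nothing        x y _ _ = refl
  onHead-antisymmetric nothing        (just (suc _)) x y _ _ = refl
  onHead-antisymmetric nothing        nothing        x y _ _ = refl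

-- Terms selecting the head coordinate cancel in pairs false ∷ X, true ∷ X; the
-- others are handled in each half by the tail of the selection.
sumOver-fixedPoints : ∀ n (c : Subset n → Maybe (Fin n)) (f : Subset n → ℤ) → SignReversing c f →
  sumOver n f ≡ sumOver n (λ F → onNothing (c F) (f F))
sumOver-fixedPoints zero c f _ with c []
... | nothing = refl
... | just ()
sumOver-fixedPoints (suc n) c f reversing = begin
  sumOver (suc n) f                                ≡⟨ sumOver-cong (suc n) (λ F → sym (onHead+offHead (c F) (f F))) ⟩
  sumOver (suc n) (λ F → head F + rest F)          ≡⟨ sumOver-+ (suc n) head rest ⟩
  sumOver (suc n) head + sumOver (suc n) rest      ≡⟨ cong (_+ sumOver (suc n) rest) (sumOver-antisymmetric-head n head headPairs) ⟩
  0ℤ + sumOver (suc n) rest                        ≡⟨ +-identityˡ _ ⟩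
  sumOver (suc n) rest                             ≡⟨ cong₂ _+_ (tail false) (tail true) ⟩
  sumOver (suc n) (λ F → onNothing (c F) (f F))    ∎
  where
  head rest : Subset (suc n) → ℤ
  head F = onHead (c F) (f F)
  rest F = offHead (c F) (f F)

  headPairs : ∀ X → head (true ∷ X) ≡ - head (false ∷ X)
  headPairs X = onHead-antisymmetric (c (false ∷ X)) (c (true ∷ X)) _ _
    (reversing (false ∷ X) zero)
    (λ e → proj₁ (reversing (true ∷ X) zero e))

  tailReversing : ∀ b → SignReversing (λ X → predMaybe (c (b ∷ X))) (λ X → rest (b ∷ X))
  tailReversing b X j e with c≡ ← predMaybe-just _ j e | reversing (b ∷ X) (suc j) c≡
  ... | c′≡ , f′≡ rewrite c≡ | c′≡ = refl , f′≡

  tail : ∀ b → sumOver n (λ X → rest (b ∷ X))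
             ≡ sumOver n (λ X → onNothing (c (b ∷ X)) (f (b ∷ X)))
  tail b = trans (sumOver-fixedPoints n _ _ (tailReversing b))
                 (sumOver-cong n (λ X → onNothing-predMaybe (c (b ∷ X)) (f (b ∷ X))))

sumℤ-++ : ∀ (xs ys : List ℤ) → sumℤ (xs ++ ys) ≡ sumℤ xs + sumℤ ys
sumℤ-++ []       ys = sym (+-identityˡ _)
sumℤ-++ (x ∷ xs) ys = trans (cong (x +_) (sumℤ-++ xs ys)) (sym (+-assoc x _ _))

sumℤ-filter : ∀ {a p} {A : Set a} {P : Pred A p} (P? : Decidable P) (g : A → ℤ) xs →
  sumℤ (map g (filter P? xs)) ≡ sumℤ (map (λ x → if does (P? x) then g x else 0ℤ) xs)
sumℤ-filter P? g []       = refl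
sumℤ-filter P? g (x ∷ xs) with does (P? x)
... | true  = cong (g x +_) (sumℤ-filter P? g xs)
... | false = trans (sumℤ-filter P? g xs) (sym (+-identityˡ _))

sumℤ-allSubsets : ∀ n (g : Subset n → ℤ) → sumℤ (map g (allSubsets n)) ≡ sumOver n g
sumℤ-allSubsets zero    g = +-identityʳ (g [])
sumℤ-allSubsets (suc n) g = begin
  sumℤ (map g (map (false ∷_) (allSubsets n) ++ map (true ∷_) (allSubsets n)))
    ≡⟨ cong sumℤ (map-++ g (map (false ∷_) (allSubsets n)) (map (true ∷_) (allSubsets n))) ⟩
  sumℤ (map g (map (false ∷_) (allSubsets n)) ++ map g (map (true ∷_) (allSubsets n)))
    ≡⟨ sumℤ-++ (map g (map (false ∷_) (allSubsets n))) (map g (map (true ∷_) (allSubsets n))) ⟩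
  sumℤ (map g (map (false ∷_) (allSubsets n))) + sumℤ (map g (map (true ∷_) (allSubsets n)))
    ≡⟨ cong₂ _+_ (half false) (half true) ⟩
  sumOver (suc n) g ∎
  where
  half : ∀ b → sumℤ (map g (map (b ∷_) (allSubsets n))) ≡ sumOver n (λ X → g (b ∷ X))
  half b = trans (cong sumℤ (sym (map-∘ (allSubsets n)))) (sumℤ-allSubsets n (λ X → g (b ∷ X)))

shadeTerm : ∀ {n} → (Subset n → Subset n) → Subset n → Subset n → ℤ
shadeTerm Shade G F = if does (G ⊆? Shade F) then sign ∣ F ∣ else 0ℤ

shadeSum-sumOver : ∀ {n} (Shade : Subset n → Subset n) G → shadeSum Shade G ≡ sumOver n (shadeTerm Shade G)
shadeSum-sumOver {n} Shade G =
  trans (sumℤ-filter (λ F → G ⊆? Shade F) (λ F → sign ∣ F ∣) (allSubsets n))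
        (sumℤ-allSubsets n (shadeTerm Shade G))

shadeTerm-⊆ : ∀ {n} (Shade : Subset n → Subset n) {G F} → G ⊆ Shade F → shadeTerm Shade G F ≡ sign ∣ F ∣
shadeTerm-⊆ Shade {G} {F} G⊆ = cong (if_then sign ∣ F ∣ else 0ℤ) (dec-true (G ⊆? Shade F) G⊆)

pointOutside : ∀ {n} → Subset n → Maybe (Fin n)
pointOutside S with nonempty? (∁ S)
... | yes (i , _) = just i
... | no _        = nothing

pointOutside-∉ : ∀ {n} (S : Subset n) i → pointOutside S ≡ just i → i ∉ S
pointOutside-∉ S i e with nonempty? (∁ S)
pointOutside-∉ S i refl | yes (.i , i∈∁S) = x∈∁p⇒x∉p i∈∁S

pointOutside-nothing : ∀ {n} (S : Subset n) → pointOutside S ≡ nothing → ∀ G → G ⊆ S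
pointOutside-nothing S e G {x} _ with nonempty? (∁ S) | x ∈? S
... | no ∁S-empty | yes x∈S = x∈S
... | no ∁S-empty | no x∉S  = contradiction (x , x∉p⇒x∈∁p x∉S) ∁S-empty
pointOutside-nothing S () G _ | yes _ | _

module _ {n : ℕ} {Shade : Subset n → Subset n} (isShade : IsShadeMap Shade) where
  open IsShadeMap isShade

  shade-toggle : ∀ F i → i ∉ Shade F → Shade (toggle i F) ≡ Shade F
  shade-toggle F i i∉ with i ∈? F
  ... | yes i∈F = trans (cong Shade (toggle-∈ i F i∈F)) (axiom2 F i i∉)
  ... | no  i∉F = trans (cong Shade (toggle-∉ i F i∉F)) (axiom1 F i i∉)

  shadeTerm-signReversing : ∀ G → SignReversing (λ F → pointOutside (Shade F)) (shadeTerm Shade G)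
  shadeTerm-signReversing G F i e = trans (cong pointOutside same) e , sign-reversed
    where
    same : Shade (toggle i F) ≡ Shade F
    same = shade-toggle F i (pointOutside-∉ (Shade F) i e)

    sign-reversed : shadeTerm Shade G (toggle i F) ≡ - shadeTerm Shade G F
    sign-reversed rewrite same with does (G ⊆? Shade F)
    ... | true  = sign-toggle i F
    ... | false = refl

  shadeTerm-sum-independent : ∀ G →
    sumOver n (shadeTerm Shade G) ≡ sumOver n (λ F → onNothing (pointOutside (Shade F)) (sign ∣ F ∣))
  shadeTerm-sum-independent G =
    trans (sumOver-fixedPoints n _ _ (shadeTerm-signReversing G)) (sumOver-cong n atFixedPoint)
    where
    atFixedPoint : ∀ F → onNothing (pointOutside (Shade F)) (shadeTerm Shade G F)
                       ≡ onNothing (pointOutside (Shade F)) (sign ∣ F ∣)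
    atFixedPoint F with pointOutside (Shade F) in e
    ... | just _  = refl
    ... | nothing = shadeTerm-⊆ Shade (pointOutside-nothing (Shade F) e G)

theorem4p3 : (n : ℕ) (Shade : Subset (suc n) → Subset (suc n)) →
    IsShadeMap Shade → (G : Subset (suc n)) → shadeSum Shade G ≡ 0ℤ
theorem4p3 n Shade isShade G = begin
  shadeSum Shade G
    ≡⟨ shadeSum-sumOver Shade G ⟩
  sumOver (suc n) (shadeTerm Shade G)
    ≡⟨ shadeTerm-sum-independent isShade G ⟩
  sumOver (suc n) (λ F → onNothing (pointOutside (Shade F)) (sign ∣ F ∣))
    ≡⟨ shadeTerm-sum-independent isShade ⊥ ⟨
  sumOver (suc n) (shadeTerm Shade ⊥)
    ≡⟨ sumOver-cong (suc n) (λ F → shadeTerm-⊆ Shade (⊆-min (Shade F))) ⟩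
  sumOver (suc n) (λ F → sign ∣ F ∣)
    ≡⟨ sumOver-antisymmetric-head n (λ F → sign ∣ F ∣) (λ X → refl) ⟩
  0ℤ ∎
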